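{- Suppose $G$ is a regular directed graph with $N$ vertices whose mixing ratio satisfies $\lambda(G)<1/N^2$. Then for every pair of vertices $u$ and $v$ of $G$, there is an edge from $u$ to $v$.
   Context: Directed graphs may have parallel edges and self-loops. A directed graph is $d$-regular if every vertex has in-degree and out-degree $d$. For a $d$-regular graph on $N$ vertices, the normalized adjacency matrix $M$ has $M_{i,j}$ equal to the number of edges from $j$ to $i$, divided by $d$. With $\vec1=\langle1/N,\dots,1/N\rangle$, the mixing ratio $\lambda(G)$ is the least $\eta\ge0$ such that $\|M\vec v\|\le\eta\|\vec v\|$ for all real vectors $\vec v$ with $\langle\vec v,\vec 1\rangle=0$, where $\|\cdot\|$ is the Euclidean norm. The mixing ratio is defined only for regular graphs. -}

module Defs where

open import Data.Nat as ℕ using (ℕ; zero; suc; NonZero)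
open import Data.Fin using (Fin; zero; suc)
open import Data.Integer using (+_)
open import Data.Rational using (ℚ; 0ℚ; _+_; _*_; _/_; _≤_)
open import Data.Product using (Σ; _×_)
open import Relation.Binary.PropositionalEquality using (_≡_)

Σℕ : ∀ {n} → (Fin n → ℕ) → ℕ
Σℕ {zero}  f = 0
Σℕ {suc n} f = f zero ℕ.+ Σℕ (λ i → f (suc i))

Σℚ : ∀ {n} → (Fin n → ℚ) → ℚ
Σℚ {zero}  f = 0ℚ
Σℚ {suc n} f = f zero + Σℚ (λ i → f (suc i))

-- A directed multigraph (parallel edges and self-loops allowed) on vertex set
-- Fin N, given by edge multiplicities: E u v = number of edges from u to v.
Digraph : ℕ → Set
Digraph N = Fin N → Fin N → ℕ

IsRegular : ∀ {N} → Digraph N → ℕ → Set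
IsRegular {N} E d =
  ((u : Fin N) → Σℕ (λ v → E u v) ≡ d) × ((v : Fin N) → Σℕ (λ u → E u v) ≡ d)

normAdj : ∀ {N} → Digraph N → (d : ℕ) → .{{NonZero d}} → Fin N → Fin N → ℚ
normAdj E d i j = (+ E j i) / d

_·ᵥ_ : ∀ {N} → (Fin N → Fin N → ℚ) → (Fin N → ℚ) → Fin N → ℚ
(M ·ᵥ v) i = Σℚ (λ j → M i j * v j)

⟨_,_⟩ : ∀ {N} → (Fin N → ℚ) → (Fin N → ℚ) → ℚ
⟨ v , w ⟩ = Σℚ (λ i → v i * w i)

‖_‖² : ∀ {N} → (Fin N → ℚ) → ℚ
‖ v ‖² = ⟨ v , v ⟩

uniform : ∀ {N} → Fin N → ℚ
uniform {suc n} _ = (+ 1) / suc n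

MixingBound : ∀ {N} → Digraph N → (d : ℕ) → .{{NonZero d}} → ℚ → Set
MixingBound {N} E d η =
  (v : Fin N → ℚ) → ⟨ v , uniform ⟩ ≡ 0ℚ →
  ‖ normAdj E d ·ᵥ v ‖² ≤ (η * η) * ‖ v ‖²

-- λ(G) < r  (λ(G) the least η ≥ 0 with the mixing bound):
-- equivalently, some rational η with 0 ≤ η < r satisfies the bound.
MixingRatioBelow : ∀ {N} → (E : Digraph N) → (d : ℕ) → .{{NonZero d}} → ℚ → Set
MixingRatioBelow {N} E d r = Σ ℚ (λ η → (0ℚ ≤ η) × (η Data.Rational.< r) × MixingBound E d η)

-- Test the mixing bound η on x = eᵤ − 1, where 1 = (1/N, …, 1/N): x ⊥ 1 and
-- ‖x‖² = ⟨x, eᵤ⟩ = 1 − 1/N ≤ 1. Each row of M sums to 1 because every in-degree is d,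
-- so (M x)ᵥ = Mᵥᵤ − 1/N, which is −1/N if there is no edge u → v. Then
-- 1/N² ≤ ‖M x‖² ≤ η² ‖x‖² ≤ η², impossible when η < 1/N² ≤ 1/N.
module Submission where

open import Defs
open import Data.Nat using (ℕ; NonZero; _≥_)
open import Data.Fin using (Fin)
open import Data.Integer using (+_)
open import Data.Rational using (_/_; _*_)

import Data.Nat as ℕ
import Data.Nat.Properties as ℕ
open import Data.Fin using (zero; suc)
import Data.Integer as ℤ
import Data.Integer.Properties as ℤ
open import Data.Integer.Tactic.RingSolver using (solve-∀)
open import Data.Rational
  using (ℚ; 0ℚ; 1ℚ; _+_; _-_; -_; _≤_; _<_; toℚᵘ; nonNegative; nonPositive; positive)
open import Data.Rational.Properties
open import Data.Rational.Unnormalised as ℚᵘ using (mkℚᵘ; *≡*)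
import Data.Rational.Unnormalised.Properties as ℚᵘ
open import Algebra.Bundles using (AbelianGroup)
open import Algebra.Properties.CommutativeSemigroup
  (AbelianGroup.commutativeSemigroup +-0-abelianGroup) using (interchange)
open import Algebra.Properties.Group +-0-group using (⁻¹-involutive)
open import Algebra.Properties.Ring +-*-ring using (x[y-z]≈xy-xz)
open import Data.Product using (_,_)
open import Data.Sum using (inj₁; inj₂)
open import Relation.Binary.PropositionalEquality

-- i / suc k is fromℚᵘ (mkℚᵘ i k) by definition, so toℚᵘ-fromℚᵘ unfolds it without normalising.
/-distribʳ-+ : ∀ i j d .{{_ : NonZero d}} → (i ℤ.+ j) / d ≡ i / d + j / d
/-distribʳ-+ i j d@(ℕ.suc k) = toℚᵘ-injective (begin
  toℚᵘ ((i ℤ.+ j) / d)              ≈⟨ toℚᵘ-fromℚᵘ (mkℚᵘ (i ℤ.+ j) k) ⟩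
  mkℚᵘ (i ℤ.+ j) k                  ≈⟨ *≡* (common-denominator i j (+ d)) ⟨
  mkℚᵘ i k ℚᵘ.+ mkℚᵘ j k            ≈⟨ ℚᵘ.+-cong (toℚᵘ-fromℚᵘ (mkℚᵘ i k)) (toℚᵘ-fromℚᵘ (mkℚᵘ j k)) ⟨
  toℚᵘ (i / d) ℚᵘ.+ toℚᵘ (j / d)    ≈⟨ toℚᵘ-homo-+ (i / d) (j / d) ⟨
  toℚᵘ (i / d + j / d)              ∎)
  where
  open ℚᵘ.≃-Reasoning
  common-denominator : ∀ i j e → (i ℤ.* e ℤ.+ j ℤ.* e) ℤ.* e ≡ (i ℤ.+ j) ℤ.* (e ℤ.* e)
  common-denominator = solve-∀

n/n≡1 : ∀ n .{{_ : NonZero n}} → (+ n) / n ≡ 1ℚ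
n/n≡1 n@(ℕ.suc k) =
  toℚᵘ-injective (ℚᵘ.≃-trans (toℚᵘ-fromℚᵘ (mkℚᵘ (+ n) k)) (*≡* (ℤ.*-comm (+ n) (+ 1))))

p*p≥0 : ∀ p → 0ℚ ≤ p * p
p*p≥0 p with ≤-total 0ℚ p
... | inj₁ p≥0 = nonNegative⁻¹ _ {{nonNeg*nonNeg⇒nonNeg p {{nonNegative p≥0}} p {{nonNegative p≥0}}}}
... | inj₂ p≤0 = nonNegative⁻¹ _ {{nonPos*nonPos⇒nonPos p {{nonPositive p≤0}} p {{nonPositive p≤0}}}}

-p*-p≡p*p : ∀ p → - p * - p ≡ p * p
-p*-p≡p*p p = begin
  - p * - p    ≡⟨ neg-distribˡ-* p (- p) ⟨
  - (p * - p)  ≡⟨ cong -_ (neg-distribʳ-* p p) ⟨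
  - - (p * p)  ≡⟨ ⁻¹-involutive (p * p) ⟩
  p * p        ∎
  where open ≡-Reasoning

p*p≤p : ∀ {p} → 0ℚ ≤ p → p ≤ 1ℚ → p * p ≤ p
p*p≤p {p} p≥0 p≤1 = subst (p * p ≤_) (*-identityʳ p) (*-monoˡ-≤-nonNeg p {{nonNegative p≥0}} p≤1)

p<q⇒p*p<q*q : ∀ {p q} → 0ℚ ≤ p → p < q → p * p < q * q
p<q⇒p*p<q*q {p} {q} p≥0 p<q = ≤-<-trans
  (*-monoˡ-≤-nonNeg p {{nonNegative p≥0}} (<⇒≤ p<q))
  (*-monoˡ-<-pos q {{positive (≤-<-trans p≥0 p<q)}} p<q)

Σℕ[1]≡n : ∀ n → Σℕ {n} (λ _ → 1) ≡ n
Σℕ[1]≡n ℕ.zero    = refl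
Σℕ[1]≡n (ℕ.suc n) = cong ℕ.suc (Σℕ[1]≡n n)

Σℚ-cong : ∀ {n} {f g : Fin n → ℚ} → (∀ i → f i ≡ g i) → Σℚ f ≡ Σℚ g
Σℚ-cong {ℕ.zero}  f≗g = refl
Σℚ-cong {ℕ.suc n} f≗g = cong₂ _+_ (f≗g zero) (Σℚ-cong (λ i → f≗g (suc i)))

Σℚ-distrib-minus : ∀ {n} (f g : Fin n → ℚ) → Σℚ (λ i → f i - g i) ≡ Σℚ f - Σℚ g
Σℚ-distrib-minus {ℕ.zero}  f g = refl
Σℚ-distrib-minus {ℕ.suc n} f g = begin
  (f₀ - g₀) + Σℚ (λ i → f′ i - g′ i)  ≡⟨ cong (_+_ (f₀ - g₀)) (Σℚ-distrib-minus f′ g′) ⟩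
  (f₀ - g₀) + (Σℚ f′ - Σℚ g′)         ≡⟨ interchange f₀ (- g₀) (Σℚ f′) (- Σℚ g′) ⟩
  (f₀ + Σℚ f′) + (- g₀ - Σℚ g′)       ≡⟨ cong (_+_ (f₀ + Σℚ f′)) (neg-distrib-+ g₀ (Σℚ g′)) ⟨
  (f₀ + Σℚ f′) - (g₀ + Σℚ g′)         ∎
  where
  open ≡-Reasoning
  f₀ = f zero
  g₀ = g zero
  f′ = λ i → f (suc i)
  g′ = λ i → g (suc i)

*-distribʳ-Σℚ : ∀ {n} c (f : Fin n → ℚ) → Σℚ f * c ≡ Σℚ (λ i → f i * c)
*-distribʳ-Σℚ {ℕ.zero}  c f = *-zeroˡ c
*-distribʳ-Σℚ {ℕ.suc n} c f = trans
  (*-distribʳ-+ c (f zero) (Σℚ (λ i → f (suc i))))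
  (cong (_+_ (f zero * c)) (*-distribʳ-Σℚ c (λ i → f (suc i))))

Σℚ-/-Σℕ : ∀ {n} (f : Fin n → ℕ) d .{{_ : NonZero d}} → Σℚ (λ i → (+ f i) / d) ≡ (+ Σℕ f) / d
Σℚ-/-Σℕ {ℕ.zero}  f d = sym (0/n≡0 d)
Σℚ-/-Σℕ {ℕ.suc n} f d = trans
  (cong (_+_ ((+ f zero) / d)) (Σℚ-/-Σℕ (λ i → f (suc i)) d))
  (sym (/-distribʳ-+ (+ f zero) (+ Σℕ (λ i → f (suc i))) d))

Σℚ-/≡1 : ∀ {n} (f : Fin n → ℕ) d .{{_ : NonZero d}} → Σℕ f ≡ d → Σℚ (λ i → (+ f i) / d) ≡ 1ℚ
Σℚ-/≡1 f d Σf≡d = trans (Σℚ-/-Σℕ f d) (trans (cong (λ m → (+ m) / d) Σf≡d) (n/n≡1 d))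

Σℚ-nonNeg : ∀ {n} {f : Fin n → ℚ} → (∀ i → 0ℚ ≤ f i) → 0ℚ ≤ Σℚ f
Σℚ-nonNeg {ℕ.zero}  f≥0 = ≤-refl
Σℚ-nonNeg {ℕ.suc n} f≥0 = +-mono-≤ (f≥0 zero) (Σℚ-nonNeg (λ i → f≥0 (suc i)))

term≤Σℚ : ∀ {n} {f : Fin n → ℚ} → (∀ i → 0ℚ ≤ f i) → ∀ i → f i ≤ Σℚ f
term≤Σℚ {f = f} f≥0 zero = subst (_≤ Σℚ f) (+-identityʳ (f zero))
  (+-monoʳ-≤ (f zero) (Σℚ-nonNeg (λ i → f≥0 (suc i))))
term≤Σℚ {f = f} f≥0 (suc i) = subst (_≤ Σℚ f) (+-identityˡ (f (suc i)))
  (+-mono-≤ (f≥0 zero) (term≤Σℚ (λ j → f≥0 (suc j)) i))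

basis : ∀ {n} → Fin n → Fin n → ℚ
basis zero    zero    = 1ℚ
basis zero    (suc _) = 0ℚ
basis (suc _) zero    = 0ℚ
basis (suc u) (suc i) = basis u i

basis-diagonal : ∀ {n} (u : Fin n) → basis u u ≡ 1ℚ
basis-diagonal zero    = refl
basis-diagonal (suc u) = basis-diagonal u

_-ᵥ_ : ∀ {n} → (Fin n → ℚ) → (Fin n → ℚ) → Fin n → ℚ
(v -ᵥ w) i = v i - w i

⟨⟩-comm : ∀ {n} (v w : Fin n → ℚ) → ⟨ v , w ⟩ ≡ ⟨ w , v ⟩
⟨⟩-comm v w = Σℚ-cong (λ i → *-comm (v i) (w i))

⟨⟩-distribʳ-minus : ∀ {n} (v w z : Fin n → ℚ) → ⟨ v , w -ᵥ z ⟩ ≡ ⟨ v , w ⟩ - ⟨ v , z ⟩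
⟨⟩-distribʳ-minus v w z = trans
  (Σℚ-cong (λ i → x[y-z]≈xy-xz (v i) (w i) (z i)))
  (Σℚ-distrib-minus (λ i → v i * w i) (λ i → v i * z i))

⟨⟩-constʳ : ∀ {n} (v : Fin n → ℚ) c → ⟨ v , (λ _ → c) ⟩ ≡ Σℚ v * c
⟨⟩-constʳ v c = sym (*-distribʳ-Σℚ c v)

⟨⟩-basisʳ : ∀ {n} (v : Fin n → ℚ) u → ⟨ v , basis u ⟩ ≡ v u
⟨⟩-basisʳ v zero = begin
  v zero * 1ℚ + ⟨ v′ , (λ _ → 0ℚ) ⟩  ≡⟨ cong₂ _+_ (*-identityʳ (v zero)) (⟨⟩-constʳ v′ 0ℚ) ⟩
  v zero + Σℚ v′ * 0ℚ                ≡⟨ cong (_+_ (v zero)) (*-zeroʳ (Σℚ v′)) ⟩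
  v zero + 0ℚ                        ≡⟨ +-identityʳ (v zero) ⟩
  v zero                             ∎
  where
  open ≡-Reasoning
  v′ = λ i → v (suc i)
⟨⟩-basisʳ v (suc u) = begin
  v zero * 0ℚ + ⟨ v′ , basis u ⟩  ≡⟨ cong₂ _+_ (*-zeroʳ (v zero)) (⟨⟩-basisʳ v′ u) ⟩
  0ℚ + v (suc u)                  ≡⟨ +-identityˡ (v (suc u)) ⟩
  v (suc u)                       ∎
  where
  open ≡-Reasoning
  v′ = λ i → v (suc i)

uniform≥0 : ∀ {n} (i : Fin n) → 0ℚ ≤ uniform i
uniform≥0 {ℕ.suc n} _ = nonNegative⁻¹ _ {{normalize-nonNeg 1 (ℕ.suc n)}}

Σℚ-uniform≡1 : ∀ n → Σℚ (uniform {ℕ.suc n}) ≡ 1ℚ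
Σℚ-uniform≡1 n = Σℚ-/≡1 {ℕ.suc n} (λ _ → 1) (ℕ.suc n) (Σℕ[1]≡n (ℕ.suc n))

Σℚ-normAdj≡1 : ∀ {N} {G : Digraph N} {d} .{{_ : NonZero d}} →
               IsRegular G d → ∀ v → Σℚ (normAdj G d v) ≡ 1ℚ
Σℚ-normAdj≡1 {G = G} {d} (_ , in-degree) v = Σℚ-/≡1 (λ j → G j v) d (in-degree v)

centredBasis : ∀ {n} → Fin n → Fin n → ℚ
centredBasis u = basis u -ᵥ uniform

⟨⟩-centredBasisʳ : ∀ {n} (w : Fin (ℕ.suc n) → ℚ) u → Σℚ w ≡ 1ℚ →
                   ⟨ w , centredBasis u ⟩ ≡ w u - (+ 1) / ℕ.suc n
⟨⟩-centredBasisʳ {n} w u Σw≡1 = begin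
  ⟨ w , basis u -ᵥ uniform ⟩         ≡⟨ ⟨⟩-distribʳ-minus w (basis u) uniform ⟩
  ⟨ w , basis u ⟩ - ⟨ w , uniform ⟩  ≡⟨ cong₂ _-_ (⟨⟩-basisʳ w u) (⟨⟩-constʳ w t) ⟩
  w u - Σℚ w * t                     ≡⟨ cong (λ s → w u - s * t) Σw≡1 ⟩
  w u - 1ℚ * t                       ≡⟨ cong (_-_ (w u)) (*-identityˡ t) ⟩
  w u - t                            ∎
  where
  open ≡-Reasoning
  t = (+ 1) / ℕ.suc n

centredBasis⊥uniform : ∀ {n} (u : Fin (ℕ.suc n)) → ⟨ centredBasis u , uniform ⟩ ≡ 0ℚ
centredBasis⊥uniform {n} u = begin
  ⟨ centredBasis u , uniform ⟩  ≡⟨ ⟨⟩-comm (centredBasis u) uniform ⟩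
  ⟨ uniform , centredBasis u ⟩  ≡⟨ ⟨⟩-centredBasisʳ uniform u (Σℚ-uniform≡1 n) ⟩
  uniform u - uniform u         ≡⟨ +-inverseʳ (uniform u) ⟩
  0ℚ                            ∎
  where open ≡-Reasoning

‖centredBasis‖²≡1-1/N : ∀ {n} (u : Fin (ℕ.suc n)) → ‖ centredBasis u ‖² ≡ 1ℚ - (+ 1) / ℕ.suc n
‖centredBasis‖²≡1-1/N u = begin
  ⟨ x , basis u -ᵥ uniform ⟩         ≡⟨ ⟨⟩-distribʳ-minus x (basis u) uniform ⟩
  ⟨ x , basis u ⟩ - ⟨ x , uniform ⟩  ≡⟨ cong₂ _-_ (⟨⟩-basisʳ x u) (centredBasis⊥uniform u) ⟩
  x u - 0ℚ                           ≡⟨ +-identityʳ (x u) ⟩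
  basis u u - uniform u              ≡⟨ cong (_- uniform u) (basis-diagonal u) ⟩
  1ℚ - uniform u                     ∎
  where
  open ≡-Reasoning
  x = centredBasis u

‖centredBasis‖²≤1 : ∀ {n} (u : Fin (ℕ.suc n)) → ‖ centredBasis u ‖² ≤ 1ℚ
‖centredBasis‖²≤1 u = begin
  ‖ centredBasis u ‖²  ≡⟨ ‖centredBasis‖²≡1-1/N u ⟩
  1ℚ - uniform u       ≤⟨ +-monoʳ-≤ 1ℚ (neg-antimono-≤ (uniform≥0 u)) ⟩
  1ℚ + 0ℚ              ≡⟨ +-identityʳ 1ℚ ⟩
  1ℚ                   ∎
  where open ≤-Reasoning

missingEdge⇒1/N²≤η² : ∀ {n} (G : Digraph (ℕ.suc n)) d .{{_ : NonZero d}} η →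
                     IsRegular G d → MixingBound G d η → ∀ {u v} → G u v ≡ 0 →
                     ((+ 1) / ℕ.suc n) * ((+ 1) / ℕ.suc n) ≤ η * η
missingEdge⇒1/N²≤η² {n} G d η regular bound {u} {v} Guv≡0 = begin
  t * t           ≡⟨ -p*-p≡p*p t ⟨
  - t * - t       ≡⟨ cong (λ s → s * s) Mx[v]≡-t ⟨
  Mx v * Mx v     ≤⟨ term≤Σℚ (λ i → p*p≥0 (Mx i)) v ⟩
  ‖ Mx ‖²         ≤⟨ bound x (centredBasis⊥uniform u) ⟩
  η * η * ‖ x ‖²  ≤⟨ *-monoˡ-≤-nonNeg (η * η) {{nonNegative (p*p≥0 η)}} (‖centredBasis‖²≤1 u) ⟩
  η * η * 1ℚ      ≡⟨ *-identityʳ (η * η) ⟩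
  η * η           ∎
  where
  open ≤-Reasoning
  t = (+ 1) / ℕ.suc n
  x = centredBasis u
  Mx = normAdj G d ·ᵥ x
  Mx[v]≡-t : Mx v ≡ - t
  Mx[v]≡-t = begin-equality
    Mx v               ≡⟨ ⟨⟩-centredBasisʳ (normAdj G d v) u (Σℚ-normAdj≡1 {G = G} regular v) ⟩
    (+ G u v) / d - t  ≡⟨ cong (λ m → (+ m) / d - t) Guv≡0 ⟩
    (+ 0) / d - t      ≡⟨ cong (_- t) (0/n≡0 d) ⟩
    0ℚ - t             ≡⟨ +-identityˡ (- t) ⟩
    - t                ∎

theorem3p4 : (N : ℕ) .{{_ : NonZero N}} (G : Digraph N) (d : ℕ) .{{_ : NonZero d}} →
    IsRegular G d →
    MixingRatioBelow G d (((+ 1) / N) * ((+ 1) / N)) →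
    (u v : Fin N) → G u v ≥ 1
theorem3p4 (ℕ.suc n) G d regular (η , η≥0 , η<t² , bound) u v = ℕ.n≢0⇒n>0 λ Guv≡0 →
  <-irrefl refl (begin-strict
    t * t  ≤⟨ missingEdge⇒1/N²≤η² G d η regular bound Guv≡0 ⟩
    η * η  <⟨ p<q⇒p*p<q*q η≥0 (<-≤-trans η<t² (p*p≤p (uniform≥0 u) t≤1)) ⟩
    t * t  ∎)
  where
  open ≤-Reasoning
  t = (+ 1) / ℕ.suc n
  t≤1 : t ≤ 1ℚ
  t≤1 = subst (t ≤_) (Σℚ-uniform≡1 n) (term≤Σℚ uniform≥0 u)
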